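{- For every base $\mathcal{B}$, atomic multisets $L,K$ and formulae $\varphi,\psi$: if $\Vdash^{L}_{\mathcal{B}}\,!\varphi$ and $!\varphi\Vdash^{K}_{\mathcal{B}}\psi$, then $\Vdash^{L\uplus K}_{\mathcal{B}}\psi$.
   Context: Fix a set $\mathbb{A}$ of propositional atoms. All multisets are finite; $\uplus$ denotes multiset union; an atomic multiset is a finite multiset of atoms. Formulae: $\varphi ::= p\in\mathbb{A}\mid\top\mid 0\mid 1\mid\varphi\multimap\varphi\mid\varphi\otimes\varphi\mid\varphi\mathbin{\&}\varphi\mid\varphi\oplus\varphi\mid\,!\varphi$. Bases. An atomic sequent is a pair $P\Rightarrow p$ ($P$ atomic multiset, $p$ atom); an atomic box is a finite multiset of atomic sequents; an atomic rule is a triple $\langle\mathbf{A},\mathbf{S},p\rangle$ with $\mathbf{A}$ a finite multiset of atomic boxes, $\mathbf{S}$ an atomic box, $p$ an atom. A base is a set of atomic rules; $\mathcal{C}\supseteq\mathcal{B}$ is set inclusion. An atom $p$ is persistent in $\mathcal{B}$ if $\mathcal{B}$ contains a rule $\langle\varnothing,\mathbf{S},p\rangle$ with $\mathbf{S}\neq\varnothing$. Derivability $P\vdash_{\mathcal{B}}p$ is the smallest relation closed under: (Ref) $\{p\}\vdash_{\mathcal{B}}p$; (App) if $\langle\mathbf{A},\mathbf{S},p\rangle\in\mathcal{B}$ with $\mathbf{A}=\{\mathbf{T}_1,\dots,\mathbf{T}_m\}$, and there are $n\ge m$, atomic multisets $C_1,\dots,C_n$ and a multiset $D=\{d_{m+1},\dots,d_n\}$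 of atoms persistent in $\mathcal{B}$ with $C_i\uplus Q\vdash_{\mathcal{B}}q$ for all $i\le m$ and $Q\Rightarrow q\in\mathbf{T}_i$, $C_j\vdash_{\mathcal{B}}d_j$ for all $m<j\le n$, and $D\uplus U\vdash_{\mathcal{B}}v$ for all $U\Rightarrow v\in\mathbf{S}$, then $C_1\uplus\dots\uplus C_n\vdash_{\mathcal{B}}p$. Support. For a base $\mathcal{B}$, atomic multiset $L$: (At) $\Vdash^L_{\mathcal{B}}p$ iff $L\vdash_{\mathcal{B}}p$; ($\multimap$) $\Vdash^L_{\mathcal{B}}\varphi\multimap\psi$ iff $\varphi\Vdash^L_{\mathcal{B}}\psi$; ($\otimes$) $\Vdash^L_{\mathcal{B}}\varphi\otimes\psi$ iff for all $\mathcal{C}\supseteq\mathcal{B}$, atomic multisets $K$, atoms $p$: if $\{\varphi,\psi\}\Vdash^K_{\mathcal{C}}p$ then $\Vdash^{L\uplus K}_{\mathcal{C}}p$; ($1$) $\Vdash^L_{\mathcal{B}}1$ iff for all $\mathcal{C}\supseteq\mathcal{B}$, $K$, $p$: if $\Vdash^K_{\mathcal{C}}p$ then $\Vdash^{L\uplus K}_{\mathcal{C}}p$; ($\mathbin{\&}$) $\Vdash^L_{\mathcal{B}}\varphi\mathbin{\&}\psi$ iff $\Vdash^L_{\mathcal{B}}\varphi$ and $\Vdash^L_{\mathcal{B}}\psi$; ($\oplus$) $\Vdash^L_{\mathcal{B}}\varphi\oplus\psi$ iff for all $\mathcal{C}\supseteq\mathcal{B}$, $K$, $p$: if $\varphi\Vdash^K_{\mathcal{C}}p$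 and $\psi\Vdash^K_{\mathcal{C}}p$ then $\Vdash^{L\uplus K}_{\mathcal{C}}p$; ($0$) $\Vdash^L_{\mathcal{B}}0$ iff $\Vdash^{L\uplus K}_{\mathcal{B}}p$ for all atoms $p$ and atomic multisets $K$; ($\top$) $\Vdash^L_{\mathcal{B}}\top$ always; ($!$) $\Vdash^L_{\mathcal{B}}\,!\varphi$ iff for all $\mathcal{C}\supseteq\mathcal{B}$, $K$, $p$: if (for all $\mathcal{D}\supseteq\mathcal{C}$, $\Vdash^{\varnothing}_{\mathcal{D}}\varphi$ implies $\Vdash^K_{\mathcal{D}}p$) then $\Vdash^{L\uplus K}_{\mathcal{C}}p$. Multisets: $\Vdash^L_{\mathcal{B}}\varnothing$ iff $L=\varnothing$; $\Vdash^L_{\mathcal{B}}\{\varphi\}$ iff $\Vdash^L_{\mathcal{B}}\varphi$; $\Vdash^L_{\mathcal{B}}\Gamma\uplus\Delta$ iff $L=K\uplus M$ for some $K,M$ with $\Vdash^K_{\mathcal{B}}\Gamma$, $\Vdash^M_{\mathcal{B}}\Delta$. (Inf) For non-empty $\Gamma$, write $\Gamma=\,!\Delta\uplus\Theta$ with $!\Delta$ the elements whose top-level connective is $!$ and $\Theta$ the rest; $\Gamma\Vdash^L_{\mathcal{B}}\varphi$ iff for all $\mathcal{C}\supseteq\mathcal{B}$ and atomic $K$: if $\Vdash^{\varnothing}_{\mathcal{C}}\delta$ for every $\delta\in\Delta$ and $\Vdash^K_{\mathcal{C}}\Theta$, then $\Vdash^{L\uplus K}_{\mathcal{C}}\varphi$.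 For $\Gamma=\varnothing$, $\Gamma\Vdash^L_{\mathcal{B}}\varphi$ means $\Vdash^L_{\mathcal{B}}\varphi$. -}

module Defs where

open import Level using (Level; Lift; lift; 0ℓ) renaming (suc to lsuc)
open import Data.Unit using (⊤)
open import Data.List using (List; []; _∷_; [_]; _++_; map; concat)
open import Data.List.Relation.Unary.All using (All)
open import Data.List.Relation.Binary.Permutation.Propositional using (_↭_)
open import Data.Product using (Σ; _×_; _,_; proj₁; proj₂; ∃₂)
open import Relation.Binary.PropositionalEquality using (_≡_; _≢_)

-- Multisets are represented by lists; multiset equality is `_↭_`
-- (permutation), multiset union is `_++_`.
module ILL (Atom : Set) where

  AtomicMultiset : Set
  AtomicMultiset = List Atom

  Sequent : Set
  Sequent = AtomicMultiset × Atom

  Box : Set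
  Box = List Sequent

  Rule : Set
  Rule = List Box × Box × Atom

  Base : Set₁
  Base = Rule → Set

  _⊆_ : Base → Base → Set
  B ⊆ C = ∀ {r} → B r → C r

  Persistent : Base → Atom → Set
  Persistent B p = Σ Box λ S → S ≢ [] × B ([] , S , p)

  data Der (B : Base) : AtomicMultiset → Atom → Set where
    ref : ∀ {p} → Der B [ p ] p
    app : ∀ {A S p P}
        → B (A , S , p)
        -- premises: (C_i , T_i) for i ≤ m, with A = {T_1,…,T_m}
        → (prems : List (AtomicMultiset × Box))
        → map proj₂ prems ≡ A
        → All (λ CT → All (λ Qq → Der B (proj₁ CT ++ proj₁ Qq) (proj₂ Qq)) (proj₂ CT)) prems
        -- extra: (C_j , d_j) for m < j ≤ n, d_j persistent, C_j ⊢ d_j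
        → (ext : List (AtomicMultiset × Atom))
        → All (λ Cd → Persistent B (proj₂ Cd) × Der B (proj₁ Cd) (proj₂ Cd)) ext
        -- D ⊎ U ⊢ v for all U ⇒ v ∈ S, where D = {d_{m+1},…,d_n}
        → All (λ Uv → Der B (map proj₂ ext ++ proj₁ Uv) (proj₂ Uv)) S
        → P ↭ (concat (map proj₁ prems) ++ concat (map proj₁ ext))
        → Der B P p

  infixr 5 _⊸_
  infixr 6 _⊗_ _&_ _⊕_
  data Formula : Set where
    atom : Atom → Formula
    ⊤ᶠ 𝟘 𝟙 : Formula
    _⊸_ _⊗_ _&_ _⊕_ : Formula → Formula → Formula
    !_ : Formula → Formula

  -- a "semantic proposition": support relation at base B and atomic multiset L
  Sem : Set₂
  Sem = Base → AtomicMultiset → Set₁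

  -- classification of a context element: either !δ (carrying the support
  -- of δ) or a non-! formula (carrying its own support)
  data Kind : Set₂ where
    bangK  : Sem → Kind
    plainK : Sem → Kind

  bangs : List Kind → List Sem
  bangs [] = []
  bangs (bangK s ∷ ks) = s ∷ bangs ks
  bangs (plainK _ ∷ ks) = bangs ks

  plains : List Kind → List Sem
  plains [] = []
  plains (bangK _ ∷ ks) = plains ks
  plains (plainK s ∷ ks) = s ∷ plains ks

  MS : List Sem → Sem
  MS [] B L = Lift (lsuc 0ℓ) (L ≡ [])
  MS (s ∷ []) B L = s B L
  MS (s ∷ t ∷ ss) B L = ∃₂ λ K M → (L ↭ K ++ M) × s B K × MS (t ∷ ss) B M

  AllEmpty : List Sem → Base → Set₁
  AllEmpty [] C = Lift (lsuc 0ℓ) ⊤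
  AllEmpty (s ∷ ss) C = s C [] × AllEmpty ss C

  InfS : List Kind → Sem → Sem
  InfS [] concl B L = concl B L
  InfS (k ∷ ks) concl B L =
    ∀ C → B ⊆ C → ∀ K →
      AllEmpty (bangs (k ∷ ks)) C →
      MS (plains (k ∷ ks)) C K →
      concl C (L ++ K)

  atomSem : Atom → Sem
  atomSem p B L = Lift (lsuc 0ℓ) (Der B L p)

  mutual
    supp : Formula → Sem
    supp (atom p) B L = Lift (lsuc 0ℓ) (Der B L p)
    supp (φ ⊸ ψ) B L = InfS (kind φ ∷ []) (supp ψ) B L
    supp (φ ⊗ ψ) B L =
      ∀ C → B ⊆ C → ∀ K p →
        InfS (kind φ ∷ kind ψ ∷ []) (atomSem p) C K → Der C (L ++ K) p
    supp 𝟙 B L = ∀ C → B ⊆ C → ∀ K p → Der C K p → Der C (L ++ K) p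
    supp (φ & ψ) B L = supp φ B L × supp ψ B L
    supp (φ ⊕ ψ) B L =
      ∀ C → B ⊆ C → ∀ K p →
        InfS (kind φ ∷ []) (atomSem p) C K →
        InfS (kind ψ ∷ []) (atomSem p) C K →
        Der C (L ++ K) p
    supp 𝟘 B L = Lift (lsuc 0ℓ) (∀ p K → Der B (L ++ K) p)
    supp ⊤ᶠ B L = Lift (lsuc 0ℓ) ⊤
    supp (! φ) B L =
      ∀ C → B ⊆ C → ∀ K p →
        (∀ D → C ⊆ D → supp φ D [] → Der D K p) →
        Der C (L ++ K) p

    kind : Formula → Kind
    kind (! δ) = bangK (supp δ)
    kind (atom p) = plainK (supp (atom p))
    kind ⊤ᶠ = plainK (supp ⊤ᶠ)
    kind 𝟘 = plainK (supp 𝟘)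
    kind 𝟙 = plainK (supp 𝟙)
    kind (φ ⊸ ψ) = plainK (supp (φ ⊸ ψ))
    kind (φ ⊗ ψ) = plainK (supp (φ ⊗ ψ))
    kind (φ & ψ) = plainK (supp (φ & ψ))
    kind (φ ⊕ ψ) = plainK (supp (φ ⊕ ψ))

  Inf : List Formula → Formula → Base → AtomicMultiset → Set₁
  Inf Γ φ = InfS (map kind Γ) (supp φ)

{-# OPTIONS --safe #-}

-- Support for !φ is an elimination principle into atoms: L supports !φ
-- exactly when every atom p that follows from K in all extensions
-- supporting φ outright also follows from L ⊎ K.  Cutting !φ is therefore
-- immediate for atomic ψ, and it lifts to every ψ by induction: each
-- connective is either itself an elimination into atoms (⊗, ⊕, 1, !, 0)
-- or quantifies over base extensions (⊸), and in both cases the cut is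
-- performed pointwise in the larger base.  This is where monotonicity of
-- support under base extension is needed.
module Submission where

open import Defs
open import Data.List using (List; []; _∷_; _++_)
open import Data.List.Properties using (++-assoc; ++-identityʳ)
open import Data.List.Relation.Unary.All using (All; []; _∷_)
open import Data.Product using (_×_; _,_; proj₁; proj₂)
open import Function using (id; _∘_)
open import Level using (_⊔_; lift; lower) renaming (suc to lsuc; zero to lzero)
open import Relation.Binary.PropositionalEquality using (refl; subst; sym)

module _ (Atom : Set) where
  open ILL Atom

  module _ {B C : Base} (B⊆C : B ⊆ C) where
    Persistent-mono : ∀ {p} → Persistent B p → Persistent C p
    Persistent-mono (S , S≢[] , r) = S , S≢[] , B⊆C r

    mutual
      Der-mono : ∀ {P p} → Der B P p → Der C P p
      Der-mono ref = ref
      Der-mono (app r prems eq ps ext es ss perm) =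
        app (B⊆C r) prems eq (premises-mono ps) ext (extras-mono es) (sequents-mono ss) perm

      premises-mono : {prems : List (AtomicMultiset × Box)} →
        All (λ CT → All (λ Qq → Der B (proj₁ CT ++ proj₁ Qq) (proj₂ Qq)) (proj₂ CT)) prems →
        All (λ CT → All (λ Qq → Der C (proj₁ CT ++ proj₁ Qq) (proj₂ Qq)) (proj₂ CT)) prems
      premises-mono [] = []
      premises-mono (d ∷ ds) = sequents-mono d ∷ premises-mono ds

      extras-mono : {ext : List (AtomicMultiset × Atom)} →
        All (λ Cd → Persistent B (proj₂ Cd) × Der B (proj₁ Cd) (proj₂ Cd)) ext →
        All (λ Cd → Persistent C (proj₂ Cd) × Der C (proj₁ Cd) (proj₂ Cd)) ext
      extras-mono [] = []
      extras-mono ((pers , d) ∷ ds) = (Persistent-mono pers , Der-mono d) ∷ extras-mono ds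

      sequents-mono : {D : AtomicMultiset} {S : Box} →
        All (λ Uv → Der B (D ++ proj₁ Uv) (proj₂ Uv)) S →
        All (λ Uv → Der C (D ++ proj₁ Uv) (proj₂ Uv)) S
      sequents-mono [] = []
      sequents-mono (d ∷ ds) = Der-mono d ∷ sequents-mono ds

  Monotone : ∀ {ℓ} → (Base → AtomicMultiset → Set ℓ) → Set (lsuc lzero ⊔ ℓ)
  Monotone s = ∀ {B C L} → B ⊆ C → s B L → s C L

  InfS-mono : ∀ k ks s → Monotone (InfS (k ∷ ks) s)
  InfS-mono k ks s B⊆C h D C⊆D = h D (C⊆D ∘ B⊆C)

  supp-mono : ∀ φ → Monotone (supp φ)
  supp-mono (atom p) B⊆C (lift d) = lift (Der-mono B⊆C d)
  supp-mono ⊤ᶠ B⊆C h = h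
  supp-mono 𝟘 B⊆C (lift h) = lift (λ p K → Der-mono B⊆C (h p K))
  supp-mono 𝟙 B⊆C h D C⊆D = h D (C⊆D ∘ B⊆C)
  supp-mono (φ ⊸ ψ) = InfS-mono (kind φ) [] (supp ψ)
  supp-mono (φ ⊗ ψ) B⊆C h D C⊆D = h D (C⊆D ∘ B⊆C)
  supp-mono (φ & ψ) B⊆C (hφ , hψ) = supp-mono φ B⊆C hφ , supp-mono ψ B⊆C hψ
  supp-mono (φ ⊕ ψ) B⊆C h D C⊆D = h D (C⊆D ∘ B⊆C)
  supp-mono (! φ) B⊆C h D C⊆D = h D (C⊆D ∘ B⊆C)

  KindMonotone : Kind → Set₁
  KindMonotone (bangK s) = Monotone s
  KindMonotone (plainK s) = Monotone s

  kind-monotone : ∀ φ → KindMonotone (kind φ)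
  kind-monotone φ@(atom _) = supp-mono φ
  kind-monotone ⊤ᶠ _ h = h
  kind-monotone φ@𝟘 = supp-mono φ
  kind-monotone φ@𝟙 = supp-mono φ
  kind-monotone φ@(_ ⊸ _) = supp-mono φ
  kind-monotone φ@(_ ⊗ _) = supp-mono φ
  kind-monotone φ@(_ & _) = supp-mono φ
  kind-monotone φ@(_ ⊕ _) = supp-mono φ
  kind-monotone (! δ) = supp-mono δ

  bangs-monotone : ∀ {ks} → All KindMonotone ks → All Monotone (bangs ks)
  bangs-monotone [] = []
  bangs-monotone {bangK _ ∷ _} (m ∷ ms) = m ∷ bangs-monotone ms
  bangs-monotone {plainK _ ∷ _} (_ ∷ ms) = bangs-monotone ms

  plains-monotone : ∀ {ks} → All KindMonotone ks → All Monotone (plains ks)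
  plains-monotone [] = []
  plains-monotone {bangK _ ∷ _} (_ ∷ ms) = plains-monotone ms
  plains-monotone {plainK _ ∷ _} (m ∷ ms) = m ∷ plains-monotone ms

  AllEmpty-mono : ∀ {ss B C} → All Monotone ss → B ⊆ C → AllEmpty ss B → AllEmpty ss C
  AllEmpty-mono [] B⊆C h = h
  AllEmpty-mono (m ∷ ms) B⊆C (s , ss) = m B⊆C s , AllEmpty-mono ms B⊆C ss

  MS-mono : ∀ {ss} → All Monotone ss → Monotone (MS ss)
  MS-mono [] B⊆C h = h
  MS-mono (m ∷ []) B⊆C h = m B⊆C h
  MS-mono (m ∷ ms@(_ ∷ _)) B⊆C (K , M , L↭K++M , s , ss) =
    K , M , L↭K++M , m B⊆C s , MS-mono ms B⊆C ss

  -- Support for ⊗, 1 and ! has this shape, and so does support for ⊕ once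
  -- its two hypotheses are paired.
  ElimSem : ∀ {ℓ} → (Atom → Base → AtomicMultiset → Set ℓ) →
    Base → AtomicMultiset → Set (lsuc lzero ⊔ ℓ)
  ElimSem H B L = ∀ C → B ⊆ C → ∀ K p → H p C K → Der C (L ++ K) p

  BangCut : ∀ {ℓ} → Formula → (Base → AtomicMultiset → Set ℓ) → Set (lsuc lzero ⊔ ℓ)
  BangCut φ s = ∀ {B L K} →
    supp (! φ) B L → (∀ C → B ⊆ C → supp φ C [] → s C K) → s B (L ++ K)

  ElimSem-bangCut : ∀ {ℓ} φ (H : Atom → Base → AtomicMultiset → Set ℓ) →
    (∀ p → Monotone (H p)) → BangCut φ (ElimSem H)
  ElimSem-bangCut φ H H-mono {L = L} {K} bang h C B⊆C K′ p x =
    subst (λ M → Der C M p) (sym (++-assoc L K K′))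
      (bang C B⊆C (K ++ K′) p (λ D C⊆D s → h D (C⊆D ∘ B⊆C) s D id K′ p (H-mono p C⊆D x)))

  InfS-bangCut : ∀ φ k ks s → All KindMonotone (k ∷ ks) →
    BangCut φ s → BangCut φ (InfS (k ∷ ks) s)
  InfS-bangCut φ k ks s mono s-cut {L = L} {K} bang h C B⊆C K′ bangsC plainsC =
    subst (s C) (sym (++-assoc L K K′))
      (s-cut (supp-mono (! φ) B⊆C bang)
        (λ D C⊆D sφ → h D (C⊆D ∘ B⊆C) sφ D id K′
          (AllEmpty-mono (bangs-monotone mono) C⊆D bangsC)
          (MS-mono (plains-monotone mono) C⊆D plainsC)))

  supp-bangCut : ∀ φ ψ → BangCut φ (supp ψ)
  supp-bangCut φ (atom p) {B} {K = K} bang h =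
    lift (bang B id K p (λ D B⊆D s → lower (h D B⊆D s)))
  supp-bangCut φ ⊤ᶠ bang h = lift _
  supp-bangCut φ 𝟘 {B} {L} {K} bang h = lift λ p K′ →
    subst (λ M → Der B M p) (sym (++-assoc L K K′))
      (bang B id (K ++ K′) p (λ D B⊆D s → lower (h D B⊆D s) p K′))
  supp-bangCut φ 𝟙 = ElimSem-bangCut φ (λ p C K → Der C K p) (λ p B⊆C → Der-mono B⊆C)
  supp-bangCut φ (a ⊸ b) =
    InfS-bangCut φ (kind a) [] (supp b) (kind-monotone a ∷ []) (supp-bangCut φ b)
  supp-bangCut φ (a ⊗ b) =
    ElimSem-bangCut φ (λ p → InfS (kind a ∷ kind b ∷ []) (atomSem p))
      (λ p → InfS-mono (kind a) (kind b ∷ []) (atomSem p))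
  supp-bangCut φ (a & b) bang h =
    supp-bangCut φ a bang (λ C B⊆C s → proj₁ (h C B⊆C s)) ,
    supp-bangCut φ b bang (λ C B⊆C s → proj₂ (h C B⊆C s))
  supp-bangCut φ (a ⊕ b) {B} {K = K} bang h C B⊆C K′ p xa xb =
    ElimSem-bangCut φ Both Both-mono bang paired C B⊆C K′ p (xa , xb)
    where
    Both : Atom → Base → AtomicMultiset → Set₁
    Both p C K = InfS (kind a ∷ []) (atomSem p) C K × InfS (kind b ∷ []) (atomSem p) C K

    Both-mono : ∀ p → Monotone (Both p)
    Both-mono p C⊆D (xa , xb) =
      InfS-mono (kind a) [] (atomSem p) C⊆D xa , InfS-mono (kind b) [] (atomSem p) C⊆D xb

    paired : ∀ C → B ⊆ C → supp φ C [] → ElimSem Both C K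
    paired D B⊆D s E D⊆E K′ p (xa , xb) = h D B⊆D s E D⊆E K′ p xa xb
  supp-bangCut φ (! δ) =
    ElimSem-bangCut φ (λ p C K → ∀ D → C ⊆ D → supp δ D [] → Der D K p)
      (λ p B⊆C g D C⊆D → g D (C⊆D ∘ B⊆C))

mainTheorem16 : (Atom : Set) → let open ILL Atom in
    (B : Base) (L K : AtomicMultiset) (φ ψ : Formula) →
    supp (! φ) B L → Inf (! φ ∷ []) ψ B K → supp ψ B (L ++ K)
mainTheorem16 Atom B L K φ ψ bang inf =
  supp-bangCut Atom φ ψ bang
    (λ C B⊆C s → subst (supp ψ C) (++-identityʳ K) (inf C B⊆C [] (s , lift _) (lift refl)))
  where open ILL Atom
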